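{- For nonnegative integers $i,j$, say $i$ is free of $j$ if the binary expansion of $i$ has 0s in all positions where the binary expansion of $j$ has 1s. Let $b(n)$ denote the sum of the binary digits of a nonnegative integer $n$. For an indeterminate $x$, let $S(x)=(S(x)_{ij})_{i,j\ge0}$ be the infinite lower-triangular matrix with $S(x)_{ij}=x^{b(i-j)}$ if $i\ge j\ge 0$ and $i-j$ is free of $j$, and $S(x)_{ij}=0$ otherwise. Then for indeterminates $x,y$, $$S(x)\,S(y)=S(x+y).$$
   Context: Products of infinite lower-triangular matrices are defined by the usual formula, each entry being a finite sum; entries are polynomials in $x,y$. -}

module Defs where

open import Level using (Level)
open import Data.Bool using (Bool; true; false; if_then_else_; _∧_; not)
open import Data.Nat using (ℕ; zero; suc; _∸_; _^_; _≤ᵇ_; _≡ᵇ_; _+_)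
open import Data.Nat.DivMod using (_/_; _%_)
open import Data.Nat.Properties using (m^n≢0)
open import Data.Fin using (Fin; toℕ)
open import Algebra.Bundles using (CommutativeRing; Semiring)

digit : ℕ → ℕ → ℕ
digit n k = ((n / (2 ^ k)) {{m^n≢0 2 k}}) % 2

allBelow : ℕ → (ℕ → Bool) → Bool
allBelow zero    p = true
allBelow (suc m) p = allBelow m p ∧ p m

sumBelow : ℕ → (ℕ → ℕ) → ℕ
sumBelow zero    f = 0
sumBelow (suc m) f = sumBelow m f + f m

-- b(n): sum of the binary digits of n.
-- n has no nonzero binary digit at a position k ≥ n+1 (since 2^k > n), so summing
-- over positions k < n+1 covers all digits.
b : ℕ → ℕ
b n = sumBelow (suc n) (digit n)

-- i is free of j: every position where j has a 1, i has a 0.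
-- Positions where j has a 1 are all < j+1, so checking k < j+1 covers all of them.
free : ℕ → ℕ → Bool
free i j = allBelow (suc j) (λ k → not ((digit j k ≡ᵇ 1) ∧ (digit i k ≡ᵇ 1)))

module _ {c ℓ : Level} (R : CommutativeRing c ℓ) where
  open CommutativeRing R
  open import Algebra.Definitions.RawSemiring (Semiring.rawSemiring semiring) using () renaming (_^_ to _^ᴿ_; sum to sumᴿ)

  Matrix : Set c
  Matrix = ℕ → ℕ → Carrier

  S : Carrier → Matrix
  S x i j = if (j ≤ᵇ i) ∧ free (i ∸ j) j then x ^ᴿ b (i ∸ j) else 0#

  -- product of lower-triangular infinite matrices: (A B)_{ik} = Σ_{j=0}^{i} A_{ij} B_{jk}
  -- (the usual formula; all terms with j > i vanish since A is lower-triangular)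
  _⊗_ : Matrix → Matrix → Matrix
  (A ⊗ B) i k = sumᴿ {suc i} (λ (j : Fin (suc i)) → A i (toℕ j) * B (toℕ j) k)

-- S(x) is self-similar under the binary splitting of indices: writing i = 2m + a and
-- j = 2l + e with bits a, e, one has S(x)_{ij} = S(x)_{ae} S(x)_{ml}, i.e. S(x) is the
-- Kronecker product of its 2 × 2 corner P(x) = [[1,0],[x,1]] with S(x) itself (subtracting
-- bitwise, i - j is free of j exactly when no borrow occurs, and b adds up over the bits).
-- Since P(x) P(y) = P(x + y), row i of S(x) S(y) factors as a corner identity times row m
-- of the same product, and strong induction on i concludes.
module Submission where

open import Defs
open import Level using (Level)
open import Data.Nat using (ℕ; suc)
open import Algebra.Bundles using (CommutativeRing; Semiring)

module Binary where
  open import Data.Bool using (Bool; true; false; not; _∧_; _xor_; f≤t; b≤b)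
    renaming (_≤_ to _≤𝔹_)
  open import Data.Nat
    using (ℕ; zero; suc; pred; _+_; _*_; _∸_; _^_; _≤_; _<_; _≡ᵇ_; _≤?_; z≤n; s≤s)
  open import Data.Nat.Properties
  open import Data.Bool.Properties using (∧-assoc; ∧-identityʳ)
  open import Data.Nat.DivMod
  open import Data.Nat.Divisibility using (divides)
  open import Relation.Binary.PropositionalEquality
  open import Relation.Nullary using (yes; no)

  bitValue : Bool → ℕ
  bitValue false = 0
  bitValue true  = 1

  bit : Bool → ℕ → ℕ
  bit a m = bitValue a + m * 2

  e∧[a-xor-e]≡false : ∀ {a e} → e ≤𝔹 a → e ∧ (a xor e) ≡ false
  e∧[a-xor-e]≡false f≤t               = refl
  e∧[a-xor-e]≡false {a = false} b≤b = refl
  e∧[a-xor-e]≡false {a = true}  b≤b = refl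

  data BitView : ℕ → Set where
    bit-view : ∀ a m → BitView (bit a m)

  bitView : ∀ n → BitView n
  bitView zero = bit-view false 0
  bitView (suc n) with bitView n
  ... | bit-view false m = bit-view true m
  ... | bit-view true  m = bit-view false (suc m)

  bit%2 : ∀ a m → bit a m % 2 ≡ bitValue a
  bit%2 false m = m*n%n≡0 m 2
  bit%2 true  m = [m+kn]%n≡m%n 1 m 2

  bit/2 : ∀ a m → bit a m / 2 ≡ m
  bit/2 a m = trans (+-distrib-/-∣ʳ (bitValue a) (divides m refl))
                    (cong₂ _+_ (bitValue/2 a) (m*n/n≡m m 2))
    where
    bitValue/2 : ∀ a → bitValue a / 2 ≡ 0
    bitValue/2 false = refl
    bitValue/2 true  = refl

  m≤bit : ∀ a m → m ≤ bit a m
  m≤bit a m = ≤-trans (m≤m*n m 2) (m≤n+m (m * 2) (bitValue a))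

  bit<double-suc : ∀ a m → bit a m < suc m * 2
  bit<double-suc false m = n≤1+n (suc (m * 2))
  bit<double-suc true  m = ≤-refl

  bit-mono-≤ : ∀ {a e m j} → e ≤𝔹 a → j ≤ m → bit e j ≤ bit a m
  bit-mono-≤ f≤t         j≤m = m≤n⇒m≤1+n (*-monoˡ-≤ 2 j≤m)
  bit-mono-≤ {a = false} b≤b j≤m = *-monoˡ-≤ 2 j≤m
  bit-mono-≤ {a = true}  b≤b j≤m = s≤s (*-monoˡ-≤ 2 j≤m)

  bit-cancel-≤ : ∀ {a e m j} → bit e j ≤ bit a m → j ≤ m
  bit-cancel-≤ {a} {e} {m} {j} le =
    subst₂ _≤_ (bit/2 e j) (bit/2 a m) (/-monoˡ-≤ 2 le)

  bit-∸ : ∀ {a e m j} → e ≤𝔹 a → j ≤ m → bit a m ∸ bit e j ≡ bit (a xor e) (m ∸ j)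
  bit-∸ {m = m} {j} f≤t j≤m =
    trans (+-∸-assoc 1 (*-monoˡ-≤ 2 j≤m)) (cong suc (sym (*-distribʳ-∸ 2 m j)))
  bit-∸ {a = false} {m = m} {j} b≤b j≤m = sym (*-distribʳ-∸ 2 m j)
  bit-∸ {a = true}  {m = m} {j} b≤b j≤m = sym (*-distribʳ-∸ 2 m j)

  even∸odd : ∀ {m j} → suc j ≤ m → bit false m ∸ bit true j ≡ bit true (m ∸ suc j)
  even∸odd {m} {j} 1+j≤m = begin
    m * 2 ∸ suc (j * 2)         ≡⟨ sym (pred[m∸n]≡m∸[1+n] (m * 2) (j * 2)) ⟩
    pred (m * 2 ∸ j * 2)        ≡⟨ cong pred (sym (*-distribʳ-∸ 2 m j)) ⟩
    pred ((m ∸ j) * 2)          ≡⟨ cong (λ d → pred (d * 2)) (+-∸-assoc 1 1+j≤m) ⟩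
    pred (suc (m ∸ suc j) * 2)  ∎
    where open ≡-Reasoning

  n<2^n : ∀ n → n < 2 ^ n
  n<2^n zero    = s≤s z≤n
  n<2^n (suc n) = ≤-<-trans (n<2^n n) (^-monoʳ-< 2 (s≤s (s≤s z≤n)) (n<1+n n))

  digit-zero : ∀ n → digit n 0 ≡ n % 2
  digit-zero n = cong (_% 2) (n/1≡n n)

  digit-suc : ∀ n k → digit n (suc k) ≡ digit (n / 2) k
  digit-suc n k =
    cong (_% 2) (sym (m/n/o≡m/[n*o] n 2 (2 ^ k) {{_}} {{m^n≢0 2 k}} {{m^n≢0 2 (suc k)}}))

  digit-≥ : ∀ {n k} → n ≤ k → digit n k ≡ 0
  digit-≥ {n} {k} n≤k =
    cong (_% 2) (m<n⇒m/n≡0 {{m^n≢0 2 k}} (<-≤-trans (n<2^n n) (^-monoʳ-≤ 2 n≤k)))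

  digit-bit-zero : ∀ a m → digit (bit a m) 0 ≡ bitValue a
  digit-bit-zero a m = trans (digit-zero (bit a m)) (bit%2 a m)

  digit-bit-suc : ∀ a m k → digit (bit a m) (suc k) ≡ digit m k
  digit-bit-suc a m k = trans (digit-suc (bit a m) k) (cong (λ n → digit n k) (bit/2 a m))

  sumBelow-suc : ∀ n f → sumBelow (suc n) f ≡ f 0 + sumBelow n (λ k → f (suc k))
  sumBelow-suc zero    f = +-comm 0 (f 0)
  sumBelow-suc (suc n) f = trans (cong (_+ f (suc n)) (sumBelow-suc n f)) (+-assoc (f 0) _ _)

  sumBelow-cong : ∀ n {f g} → (∀ k → f k ≡ g k) → sumBelow n f ≡ sumBelow n g
  sumBelow-cong zero    f≡g = refl
  sumBelow-cong (suc n) f≡g = cong₂ _+_ (sumBelow-cong n f≡g) (f≡g n)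

  sumBelow-vanishing : ∀ {n N} f → n ≤ N → (∀ k → n ≤ k → f k ≡ 0) →
                       sumBelow N f ≡ sumBelow n f
  sumBelow-vanishing {N = zero} f z≤n _ = refl
  sumBelow-vanishing {n} {suc N} f n≤1+N f≡0 with n ≤? N
  ... | yes n≤N = trans (cong₂ _+_ (sumBelow-vanishing f n≤N f≡0) (f≡0 N n≤N)) (+-identityʳ _)
  ... | no  n≰N = cong (λ N → sumBelow N f) (≤-antisym (≰⇒> n≰N) n≤1+N)

  allBelow-suc : ∀ n p → allBelow (suc n) p ≡ p 0 ∧ allBelow n (λ k → p (suc k))
  allBelow-suc zero    p = sym (∧-identityʳ (p 0))
  allBelow-suc (suc n) p = trans (cong (_∧ p (suc n)) (allBelow-suc n p)) (∧-assoc (p 0) _ _)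

  allBelow-cong : ∀ n {p q} → (∀ k → p k ≡ q k) → allBelow n p ≡ allBelow n q
  allBelow-cong zero    p≡q = refl
  allBelow-cong (suc n) p≡q = cong₂ _∧_ (allBelow-cong n p≡q) (p≡q n)

  allBelow-vanishing : ∀ {n N} p → n ≤ N → (∀ k → n ≤ k → p k ≡ true) →
                       allBelow N p ≡ allBelow n p
  allBelow-vanishing {N = zero} p z≤n _ = refl
  allBelow-vanishing {n} {suc N} p n≤1+N p≡t with n ≤? N
  ... | yes n≤N = trans (cong₂ _∧_ (allBelow-vanishing p n≤N p≡t) (p≡t N n≤N)) (∧-identityʳ _)
  ... | no  n≰N = cong (λ N → allBelow N p) (≤-antisym (≰⇒> n≰N) n≤1+N)

  b-sumBelow : ∀ {n N} → n ≤ N → sumBelow N (digit n) ≡ b n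
  b-sumBelow {n} n≤N =
    trans (vanish n≤N) (sym (vanish (n≤1+n n)))
    where
    vanish : ∀ {N} → n ≤ N → sumBelow N (digit n) ≡ sumBelow n (digit n)
    vanish n≤N = sumBelow-vanishing (digit n) n≤N (λ k → digit-≥)

  b-bit : ∀ a m → b (bit a m) ≡ bitValue a + b m
  b-bit a m = begin
    b (bit a m)
      ≡⟨ sumBelow-suc (bit a m) _ ⟩
    digit (bit a m) 0 + sumBelow (bit a m) (λ k → digit (bit a m) (suc k))
      ≡⟨ cong₂ _+_ (digit-bit-zero a m) (sumBelow-cong (bit a m) (digit-bit-suc a m)) ⟩
    bitValue a + sumBelow (bit a m) (digit m)
      ≡⟨ cong (bitValue a +_) (b-sumBelow (m≤bit a m)) ⟩
    bitValue a + b m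
      ∎
    where open ≡-Reasoning

  bothOne : ℕ → ℕ → ℕ → Bool
  bothOne u v k = (digit v k ≡ᵇ 1) ∧ (digit u k ≡ᵇ 1)

  free-allBelow : ∀ {u v N} → v ≤ N → allBelow N (λ k → not (bothOne u v k)) ≡ free u v
  free-allBelow {u} {v} v≤N = trans (vanish v≤N) (sym (vanish (n≤1+n v)))
    where
    disjoint : ℕ → Bool
    disjoint k = not (bothOne u v k)
    vanish : ∀ {N} → v ≤ N → allBelow N disjoint ≡ allBelow v disjoint
    vanish v≤N = allBelow-vanishing disjoint v≤N
      (λ k v≤k → cong (λ d → not ((d ≡ᵇ 1) ∧ (digit u k ≡ᵇ 1))) (digit-≥ v≤k))

  bothOne-bit-zero : ∀ a e u v → bothOne (bit a u) (bit e v) 0 ≡ e ∧ a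
  bothOne-bit-zero a e u v =
    trans (cong₂ (λ d d′ → (d ≡ᵇ 1) ∧ (d′ ≡ᵇ 1)) (digit-bit-zero e v) (digit-bit-zero a u))
          (cong₂ _∧_ (bitValue≡ᵇ1 e) (bitValue≡ᵇ1 a))
    where
    bitValue≡ᵇ1 : ∀ a → (bitValue a ≡ᵇ 1) ≡ a
    bitValue≡ᵇ1 false = refl
    bitValue≡ᵇ1 true  = refl

  bothOne-bit-suc : ∀ a e u v k → bothOne (bit a u) (bit e v) (suc k) ≡ bothOne u v k
  bothOne-bit-suc a e u v k =
    cong₂ (λ d d′ → (d ≡ᵇ 1) ∧ (d′ ≡ᵇ 1)) (digit-bit-suc e v k) (digit-bit-suc a u k)

  free-bit : ∀ a e u v → free (bit a u) (bit e v) ≡ not (e ∧ a) ∧ free u v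
  free-bit a e u v = begin
    free (bit a u) (bit e v)
      ≡⟨ allBelow-suc (bit e v) _ ⟩
    not (bothOne (bit a u) (bit e v) 0) ∧ allBelow (bit e v) (λ k → not (bothOne (bit a u) (bit e v) (suc k)))
      ≡⟨ cong₂ _∧_ (cong not (bothOne-bit-zero a e u v))
                   (allBelow-cong (bit e v) (λ k → cong not (bothOne-bit-suc a e u v k))) ⟩
    not (e ∧ a) ∧ allBelow (bit e v) (λ k → not (bothOne u v k))
      ≡⟨ cong (not (e ∧ a) ∧_) (free-allBelow (m≤bit e v)) ⟩
    not (e ∧ a) ∧ free u v
      ∎
    where open ≡-Reasoning

module Sums {c ℓ : Level} (R : Semiring c ℓ) where
  open Semiring R
  open import Algebra.Definitions.RawSemiring rawSemiring using (sum)
  open import Data.Nat using (zero; suc; _≤_; z≤n; s≤s) renaming (_*_ to _*ℕ_)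
  open import Data.Fin using (toℕ)
  open import Relation.Binary.PropositionalEquality using (_≡_; cong) renaming (refl to ≡-refl)

  Σ : ℕ → (ℕ → Carrier) → Carrier
  Σ zero    f = 0#
  Σ (suc n) f = f 0 + Σ n (λ j → f (suc j))

  sum≡Σ : ∀ n (f : ℕ → Carrier) → sum {n} (λ j → f (toℕ j)) ≡ Σ n f
  sum≡Σ zero    f = ≡-refl
  sum≡Σ (suc n) f = cong (f 0 +_) (sum≡Σ n (λ j → f (suc j)))

  Σ-cong : ∀ n {f g : ℕ → Carrier} → (∀ j → f j ≈ g j) → Σ n f ≈ Σ n g
  Σ-cong zero    f≈g = refl
  Σ-cong (suc n) f≈g = +-cong (f≈g 0) (Σ-cong n (λ j → f≈g (suc j)))

  Σ-extend : ∀ {n N} (f : ℕ → Carrier) → n ≤ N → (∀ j → n ≤ j → f j ≈ 0#) → Σ N f ≈ Σ n f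
  Σ-extend {N = zero}  f z≤n       f≈0 = refl
  Σ-extend {N = suc N} f z≤n       f≈0 =
    trans (+-cong (f≈0 0 z≤n) (Σ-extend {N = N} _ z≤n (λ j _ → f≈0 (suc j) z≤n))) (+-identityʳ 0#)
  Σ-extend {N = suc N} f (s≤s n≤N) f≈0 =
    +-congˡ (Σ-extend _ n≤N (λ j n≤j → f≈0 (suc j) (s≤s n≤j)))

  Σ-pairs : ∀ n (f : ℕ → Carrier) → Σ (n *ℕ 2) f ≈ Σ n (λ j → f (j *ℕ 2) + f (suc (j *ℕ 2)))
  Σ-pairs zero    f = refl
  Σ-pairs (suc n) f =
    trans (+-congˡ (+-congˡ (Σ-pairs n (λ j → f (suc (suc j)))))) (sym (+-assoc _ _ _))

  Σ-distribˡ : ∀ n z (f : ℕ → Carrier) → Σ n (λ j → z * f j) ≈ z * Σ n f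
  Σ-distribˡ zero    z f = sym (zeroʳ z)
  Σ-distribˡ (suc n) z f = trans (+-congˡ (Σ-distribˡ n z _)) (sym (distribˡ z _ _))

module Product {c ℓ : Level} (R : CommutativeRing c ℓ) where
  open CommutativeRing R
  open Binary
  open Sums semiring
  open import Algebra.Properties.Semiring.Exp semiring using (_^_; ^-homo-*)
  open import Algebra.Properties.CommutativeSemigroup *-commutativeSemigroup using (interchange)
  open import Data.Bool using (true; false; not; _∧_; _xor_; if_then_else_; f≤t; b≤b)
    renaming (_≤_ to _≤𝔹_)
  open import Data.Bool.Properties using (≤-maximum)
  open import Data.Nat using (zero; suc; _∸_; _≤_; _<_; _≤?_; s≤s)
    renaming (_+_ to _+ℕ_; _*_ to _*ℕ_)
  open import Data.Nat.Properties using (<⇒≱; m≤m*n)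
  open import Data.Nat.Induction using (<-rec)
  open import Function using (_∘_)
  import Relation.Binary.PropositionalEquality as ≡
  open import Relation.Binary.Reasoning.Setoid setoid
  open import Relation.Nullary using (¬_; yes; no)
  open import Relation.Nullary.Decidable using (dec-true; dec-false)

  S-below : ∀ {z i j} → j ≤ i → S R z i j ≡.≡ (if free (i ∸ j) j then z ^ b (i ∸ j) else 0#)
  S-below {z} {i} {j} j≤i =
    ≡.cong (λ c → if c ∧ free (i ∸ j) j then z ^ b (i ∸ j) else 0#) (dec-true (j ≤? i) j≤i)

  S-above : ∀ {z i j} → ¬ j ≤ i → S R z i j ≡.≡ 0#
  S-above {z} {i} {j} j≰i =
    ≡.cong (λ c → if c ∧ free (i ∸ j) j then z ^ b (i ∸ j) else 0#) (dec-false (j ≤? i) j≰i)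

  S-corner : ∀ z {a e} → e ≤𝔹 a → S R z (bitValue a) (bitValue e) ≡.≡ z ^ bitValue (a xor e)
  S-corner z f≤t               = ≡.refl
  S-corner z {a = false} b≤b = ≡.refl
  S-corner z {a = true}  b≤b = ≡.refl

  if-^-+ : ∀ c z n k → (if c then z ^ (n +ℕ k) else 0#) ≈ z ^ n * (if c then z ^ k else 0#)
  if-^-+ true  z n k = ^-homo-* z n k
  if-^-+ false z n k = sym (zeroʳ _)

  S-bit-≤ : ∀ z {a e} m j → e ≤𝔹 a →
            S R z (bit a m) (bit e j) ≈ S R z (bitValue a) (bitValue e) * S R z m j
  S-bit-≤ z {a} {e} m j e≤a with j ≤? m
  ... | no j≰m = begin
    S R z (bit a m) (bit e j)                 ≡⟨ S-above (j≰m ∘ bit-cancel-≤ {a} {e}) ⟩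
    0#                                        ≈⟨ sym (zeroʳ _) ⟩
    S R z (bitValue a) (bitValue e) * 0#      ≡⟨ ≡.cong (_ *_) (≡.sym (S-above j≰m)) ⟩
    S R z (bitValue a) (bitValue e) * S R z m j ∎
  ... | yes j≤m = begin
    S R z (bit a m) (bit e j)
      ≡⟨ S-below (bit-mono-≤ e≤a j≤m) ⟩
    (if free (bit a m ∸ bit e j) (bit e j) then z ^ b (bit a m ∸ bit e j) else 0#)
      ≡⟨ ≡.cong (λ d → if free d (bit e j) then z ^ b d else 0#) (bit-∸ e≤a j≤m) ⟩
    (if free (bit (a xor e) d) (bit e j) then z ^ b (bit (a xor e) d) else 0#)
      ≡⟨ ≡.cong₂ (λ c n → if c then z ^ n else 0#) free-d (b-bit (a xor e) d) ⟩
    (if free d j then z ^ (bitValue (a xor e) +ℕ b d) else 0#)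
      ≈⟨ if-^-+ (free d j) z (bitValue (a xor e)) (b d) ⟩
    z ^ bitValue (a xor e) * (if free d j then z ^ b d else 0#)
      ≡⟨ ≡.cong₂ _*_ (≡.sym (S-corner z e≤a)) (≡.sym (S-below j≤m)) ⟩
    S R z (bitValue a) (bitValue e) * S R z m j ∎
    where
    d = m ∸ j
    free-d : free (bit (a xor e) d) (bit e j) ≡.≡ free d j
    free-d = ≡.trans (free-bit (a xor e) e d j) (≡.cong (λ c → not c ∧ free d j) (e∧[a-xor-e]≡false e≤a))

  S-even-odd : ∀ z m j → S R z (bit false m) (bit true j) ≡.≡ 0#
  S-even-odd z m j with bit true j ≤? bit false m
  ... | no  odd≰even = S-above odd≰even
  ... | yes odd≤even = ≡.trans (S-below odd≤even) (≡.trans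
    (≡.cong (λ d → if free d (bit true j) then z ^ b d else 0#) (even∸odd {m} {j} 1+j≤m))
    (≡.cong (λ c → if c then z ^ b (bit true d) else 0#) (free-bit true true d j)))
    where
    d = m ∸ suc j
    1+j≤m : suc j ≤ m
    1+j≤m = bit-cancel-≤ {true} {false} (s≤s odd≤even)

  S-bit : ∀ z a e m j → S R z (bit a m) (bit e j) ≈ S R z (bitValue a) (bitValue e) * S R z m j
  S-bit z false true  m j = trans (reflexive (S-even-odd z m j)) (sym (zeroˡ _))
  S-bit z false false m j = S-bit-≤ z {false} {false} m j b≤b
  S-bit z true  e     m j = S-bit-≤ z {true} {e} m j (≤-maximum e)

  module _ (x y : Carrier) where

    productTerm : ℕ → ℕ → ℕ → Carrier
    productTerm i k j = S R x i j * S R y j k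

    RowIdentity : ℕ → Set ℓ
    RowIdentity i = ∀ k → Σ (suc i) (productTerm i k) ≈ S R (x + y) i k

    S-corner-product : ∀ a c → productTerm (bitValue a) (bitValue c) 0
                               + productTerm (bitValue a) (bitValue c) 1
                               ≈ S R (x + y) (bitValue a) (bitValue c)
    S-corner-product false false = trans (+-cong (*-identityˡ 1#) (zeroˡ _)) (+-identityʳ 1#)
    S-corner-product false true  = trans (+-cong (*-identityˡ 0#) (zeroˡ _)) (+-identityʳ 0#)
    S-corner-product true  false =
      trans (+-cong (*-identityʳ _) (*-identityˡ _)) (sym (distribʳ 1# x y))
    S-corner-product true  true  = trans (+-cong (zeroʳ _) (*-identityˡ 1#)) (+-identityˡ 1#)

    RowIdentity-zero : RowIdentity 0
    RowIdentity-zero zero    = trans (+-identityʳ _) (*-identityˡ 1#)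
    RowIdentity-zero (suc k) = trans (+-identityʳ _) (zeroʳ 1#)

    RowIdentity-bit : ∀ a m → RowIdentity m → RowIdentity (bit a m)
    RowIdentity-bit a m row k with bitView k
    ... | bit-view c l = begin
      Σ (suc i) (productTerm i k)
        ≈⟨ Σ-extend (productTerm i k) (bit<double-suc a m) beyond-i ⟨
      Σ (suc m *ℕ 2) (productTerm i k)
        ≈⟨ Σ-pairs (suc m) (productTerm i k) ⟩
      Σ (suc m) (λ j → productTerm i k (bit false j) + productTerm i k (bit true j))
        ≈⟨ Σ-cong (suc m) split ⟩
      Σ (suc m) (λ j → corner * productTerm m l j)
        ≈⟨ Σ-distribˡ (suc m) corner (productTerm m l) ⟩
      corner * Σ (suc m) (productTerm m l)
        ≈⟨ *-cong (S-corner-product a c) (row l) ⟩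
      S R (x + y) (bitValue a) (bitValue c) * S R (x + y) m l
        ≈⟨ S-bit (x + y) a c m l ⟨
      S R (x + y) i k ∎
      where
      i = bit a m
      corner : Carrier
      corner = productTerm (bitValue a) (bitValue c) 0 + productTerm (bitValue a) (bitValue c) 1
      beyond-i : ∀ j → suc i ≤ j → productTerm i k j ≈ 0#
      beyond-i j i<j = trans (*-congʳ (reflexive (S-above (<⇒≱ i<j)))) (zeroˡ _)
      split : ∀ j → productTerm i k (bit false j) + productTerm i k (bit true j) ≈ corner * productTerm m l j
      split j = trans (+-cong (*-cong (S-bit x a false m j) (S-bit y false c j l))
                              (*-cong (S-bit x a true m j) (S-bit y true c j l)))
                      (trans (+-cong (interchange _ _ _ _) (interchange _ _ _ _))
                             (sym (distribʳ _ _ _)))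

    rowIdentity : ∀ i → RowIdentity i
    rowIdentity = <-rec RowIdentity step
      where
      step : ∀ i → (∀ {m} → m < i → RowIdentity m) → RowIdentity i
      step i rec with bitView i
      ... | bit-view false zero    = RowIdentity-zero
      ... | bit-view false (suc m) = RowIdentity-bit false (suc m) (rec (s≤s (s≤s (m≤m*n m 2))))
      ... | bit-view true  m       = RowIdentity-bit true  m       (rec (s≤s (m≤m*n m 2)))

theorem2 : {c ℓ : Level} (R : CommutativeRing c ℓ) → (x y : CommutativeRing.Carrier R) → (i k : ℕ) → CommutativeRing._≈_ R (_⊗_ R (S R x) (S R y) i k) (S R (CommutativeRing._+_ R x y) i k)
theorem2 R x y i k =
  trans (reflexive (sum≡Σ (suc i) (λ j → S R x i j * S R y j k))) (rowIdentity x y i k)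
  where
  open CommutativeRing R
  open Sums semiring using (sum≡Σ)
  open Product R using (rowIdentity)
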